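{- Let $p$ be a prime, $A$ an $n\times m$ matrix over $\mathbb{Z}_p$, and $B$ an $A$-good basis of $\mathbb{Z}_p^m$. Then $\mathrm{rank}(A)=m-|B\cap K|$, where $K$ is the kernel of $A$.
   Context: $K=\{v\in\mathbb{Z}_p^m: Av=0\}$. For $v\in\mathbb{Z}_p^m$, $S(v)$ is the set of indices $i\in[n]$ with $(Av)_i\neq 0$. For a basis $B$ of $\mathbb{Z}_p^m$, a vector $v\in B$ is $i$-unique (with respect to $B$ and $A$) if $i\in S(v)$ but $i\notin S(w)$ for every other $w\in B$. The basis $B$ is $A$-good if every $v\in B\setminus K$ is $i$-unique for some $i\in[n]$. -}

module Defs where

open import Data.Nat using (ℕ; zero; suc; NonZero) renaming (_+_ to _+ℕ_; _*_ to _*ℕ_)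
open import Data.Nat.DivMod using (_mod_)
open import Data.Fin using (Fin; toℕ; fromℕ<) renaming (zero to fz; suc to fs)
open import Data.Fin.Properties using (all?) renaming (_≟_ to _≟F_)
open import Data.Unit using (⊤)
open import Data.Product using (Σ; ∃; ∃-syntax; _×_; _,_)
open import Relation.Nullary using (¬_; Dec; yes; no)
open import Relation.Binary.PropositionalEquality using (_≡_; _≢_)

module Zp (p : ℕ) .{{_ : NonZero p}} where

  F : Set
  F = Fin p

  0F : F
  0F = 0 mod p

  _+F_ : F → F → F
  a +F b = (toℕ a +ℕ toℕ b) mod p

  _*F_ : F → F → F
  a *F b = (toℕ a *ℕ toℕ b) mod p

  Vec : ℕ → Set
  Vec m = Fin m → F

  _≈_ : ∀ {m} → Vec m → Vec m → Set
  u ≈ v = ∀ j → u j ≡ v j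

  zeroV : ∀ {m} → Vec m
  zeroV _ = 0F

  _+V_ : ∀ {m} → Vec m → Vec m → Vec m
  (u +V v) j = u j +F v j

  _·V_ : ∀ {m} → F → Vec m → Vec m
  (c ·V v) j = c *F v j

  lincomb : ∀ {k m} → (Fin k → F) → (Fin k → Vec m) → Vec m
  lincomb {zero}  c v = zeroV
  lincomb {suc k} c v = (c fz ·V v fz) +V lincomb (λ i → c (fs i)) (λ i → v (fs i))

  LinIndep : ∀ {k m} → (Fin k → Vec m) → Set
  LinIndep v = ∀ c → lincomb c v ≈ zeroV → ∀ i → c i ≡ 0F

  SpansIn : ∀ {k m} → (Vec m → Set) → (Fin k → Vec m) → Set
  SpansIn W v = ∀ w → W w → ∃[ c ] (lincomb c v ≈ w)

  IsBasis : ∀ {k m} → (Fin k → Vec m) → Set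
  IsBasis v = LinIndep v × SpansIn (λ _ → ⊤) v

  Matrix : ℕ → ℕ → Set
  Matrix n m = Fin n → Fin m → F

  _⊛_ : ∀ {n m} → Matrix n m → Vec m → Vec n
  (A ⊛ v) i = lincomb v (λ j → λ i' → A i' j) i

  InKernel : ∀ {n m} → Matrix n m → Vec m → Set
  InKernel A v = (A ⊛ v) ≈ zeroV

  InImage : ∀ {n m} → Matrix n m → Vec n → Set
  InImage {m = m} A y = ∃[ x ] ((A ⊛ x) ≈ y)

  InS : ∀ {n m} → Matrix n m → Vec m → Fin n → Set
  InS A v i = (A ⊛ v) i ≢ 0F

  IsUnique : ∀ {n m k} → Matrix n m → (Fin k → Vec m) → Fin k → Fin n → Set
  IsUnique A B l i = InS A (B l) i × (∀ l' → l' ≢ l → ¬ InS A (B l') i)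

  IsGood : ∀ {n m k} → Matrix n m → (Fin k → Vec m) → Set
  IsGood A B = ∀ l → ¬ InKernel A (B l) → ∃[ i ] IsUnique A B l i

  HasRank : ∀ {n m} → Matrix n m → ℕ → Set
  HasRank {n} A r =
    Σ (Fin r → Vec n) λ u → (∀ j → InImage A (u j)) × LinIndep u × SpansIn (InImage A) u

  inKernel? : ∀ {n m} (A : Matrix n m) (v : Vec m) → Dec (InKernel A v)
  inKernel? A v = all? (λ i → (A ⊛ v) i ≟F 0F)

  countKernel : ∀ {n m k} → Matrix n m → (Fin k → Vec m) → ℕ
  countKernel {k = zero}  A B = 0
  countKernel {k = suc k} A B with inKernel? A (B fz)
  ... | yes _ = suc (countKernel A (λ l → B (fs l)))
  ... | no  _ = countKernel A (λ l → B (fs l))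

-- Every B_l outside K is i-unique for some row i: (A B_l)_i ≠ 0 while
-- (A B_l')_i = 0 for all l' ≠ l.  Hence the images A B_l of the non-kernel members
-- are linearly independent, and since B spans ℤ_p^m they span the column space of A.
-- So rank A = k - |B ∩ K|, and k = m because B is a basis.
module Submission where

open import Defs
open import Level using (0ℓ)
open import Data.Nat as ℕ using (ℕ; zero; suc; NonZero; _∸_; _%_; _≤_; z≤n; s≤s; nonTrivial⇒n>1)
import Data.Nat.Properties as NP
open import Data.Nat.DivMod using (_mod_; m<n⇒m%n≡m; %-distribˡ-+; %-distribˡ-*; n%n≡0; m*n%n≡0)
open import Data.Nat.Divisibility using (_∣_; n∣m⇒m%n≡0; m%n≡0⇒n∣m)
open import Data.Nat.Primality using (Prime; euclidsLemma; prime⇒nonTrivial)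
open import Data.Fin using (Fin; toℕ; zero; suc; punchIn; punchOut)
open import Data.Fin.Properties using (toℕ-fromℕ<; toℕ-injective; toℕ<n; _≟_; any?; punchIn-punchOut; suc-injective)
open import Data.Vec.Functional using (_∷_)
open import Data.Product using (_,_; proj₁; proj₂; ∃-syntax; Σ-syntax)
open import Data.Sum as Sum using (_⊎_; inj₁; inj₂)
open import Data.Unit using (⊤; tt)
open import Data.Empty using (⊥-elim)
open import Function using (id; _∘_)
open import Algebra.Bundles using (CommutativeRing)
open import Algebra.Structures using (IsCommutativeRing)
open import Algebra.Consequences.Propositional using (comm∧idˡ⇒id; comm∧invʳ⇒inv; comm∧distrˡ⇒distrʳ)
open import Relation.Nullary using (¬_; yes; no; ¬?)
open import Relation.Nullary.Decidable using (decidable-stable)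
open import Relation.Binary.PropositionalEquality
open ≡-Reasoning

-- ℤ_p is a commutative ring.  Each law is transferred from ℕ along the reduction
-- map ⌊_⌋ : ℕ → ℤ_p, which preserves + and * and is inverted by toℕ.
module ResidueRing (p : ℕ) .{{_ : NonZero p}} where
  open Zp p

  ⌊_⌋ : ℕ → F
  ⌊ x ⌋ = x mod p

  toℕ-reduce : ∀ x → toℕ ⌊ x ⌋ ≡ x % p
  toℕ-reduce x = toℕ-fromℕ< _

  reduce-toℕ : ∀ a → ⌊ toℕ a ⌋ ≡ a
  reduce-toℕ a = toℕ-injective (trans (toℕ-reduce (toℕ a)) (m<n⇒m%n≡m (toℕ<n a)))

  reduce-% : ∀ {x y} → x % p ≡ y % p → ⌊ x ⌋ ≡ ⌊ y ⌋
  reduce-% {x} {y} eq = toℕ-injective (trans (toℕ-reduce x) (trans eq (sym (toℕ-reduce y))))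

  reduce-+ : ∀ x y → ⌊ x ℕ.+ y ⌋ ≡ ⌊ x ⌋ +F ⌊ y ⌋
  reduce-+ x y = reduce-% (trans (%-distribˡ-+ x y p)
    (sym (cong₂ (λ a b → (a ℕ.+ b) % p) (toℕ-reduce x) (toℕ-reduce y))))

  reduce-* : ∀ x y → ⌊ x ℕ.* y ⌋ ≡ ⌊ x ⌋ *F ⌊ y ⌋
  reduce-* x y = reduce-% (trans (%-distribˡ-* x y p)
    (sym (cong₂ (λ a b → (a ℕ.* b) % p) (toℕ-reduce x) (toℕ-reduce y))))

  1F : F
  1F = ⌊ 1 ⌋

  -F_ : F → F
  -F a = ⌊ p ∸ toℕ a ⌋

  +F-comm : ∀ a b → a +F b ≡ b +F a
  +F-comm a b = cong ⌊_⌋ (NP.+-comm (toℕ a) (toℕ b))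

  *F-comm : ∀ a b → a *F b ≡ b *F a
  *F-comm a b = cong ⌊_⌋ (NP.*-comm (toℕ a) (toℕ b))

  +F-assoc : ∀ a b c → (a +F b) +F c ≡ a +F (b +F c)
  +F-assoc a b c = begin
    ⌊ x ℕ.+ y ⌋ +F c          ≡⟨ cong (⌊ x ℕ.+ y ⌋ +F_) (sym (reduce-toℕ c)) ⟩
    ⌊ x ℕ.+ y ⌋ +F ⌊ z ⌋      ≡⟨ sym (reduce-+ (x ℕ.+ y) z) ⟩
    ⌊ x ℕ.+ y ℕ.+ z ⌋         ≡⟨ cong ⌊_⌋ (NP.+-assoc x y z) ⟩
    ⌊ x ℕ.+ (y ℕ.+ z) ⌋       ≡⟨ reduce-+ x (y ℕ.+ z) ⟩
    ⌊ x ⌋ +F ⌊ y ℕ.+ z ⌋      ≡⟨ cong (_+F ⌊ y ℕ.+ z ⌋) (reduce-toℕ a) ⟩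
    a +F (b +F c)             ∎
    where
    x y z : ℕ
    x = toℕ a
    y = toℕ b
    z = toℕ c

  *F-assoc : ∀ a b c → (a *F b) *F c ≡ a *F (b *F c)
  *F-assoc a b c = begin
    ⌊ x ℕ.* y ⌋ *F c          ≡⟨ cong (⌊ x ℕ.* y ⌋ *F_) (sym (reduce-toℕ c)) ⟩
    ⌊ x ℕ.* y ⌋ *F ⌊ z ⌋      ≡⟨ sym (reduce-* (x ℕ.* y) z) ⟩
    ⌊ x ℕ.* y ℕ.* z ⌋         ≡⟨ cong ⌊_⌋ (NP.*-assoc x y z) ⟩
    ⌊ x ℕ.* (y ℕ.* z) ⌋       ≡⟨ reduce-* x (y ℕ.* z) ⟩
    ⌊ x ⌋ *F ⌊ y ℕ.* z ⌋      ≡⟨ cong (_*F ⌊ y ℕ.* z ⌋) (reduce-toℕ a) ⟩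
    a *F (b *F c)             ∎
    where
    x y z : ℕ
    x = toℕ a
    y = toℕ b
    z = toℕ c

  *F-distribˡ : ∀ a b c → a *F (b +F c) ≡ (a *F b) +F (a *F c)
  *F-distribˡ a b c = begin
    a *F ⌊ y ℕ.+ z ⌋          ≡⟨ cong (_*F ⌊ y ℕ.+ z ⌋) (sym (reduce-toℕ a)) ⟩
    ⌊ x ⌋ *F ⌊ y ℕ.+ z ⌋      ≡⟨ sym (reduce-* x (y ℕ.+ z)) ⟩
    ⌊ x ℕ.* (y ℕ.+ z) ⌋       ≡⟨ cong ⌊_⌋ (NP.*-distribˡ-+ x y z) ⟩
    ⌊ x ℕ.* y ℕ.+ x ℕ.* z ⌋   ≡⟨ reduce-+ (x ℕ.* y) (x ℕ.* z) ⟩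
    (a *F b) +F (a *F c)      ∎
    where
    x y z : ℕ
    x = toℕ a
    y = toℕ b
    z = toℕ c

  +F-identityˡ : ∀ a → 0F +F a ≡ a
  +F-identityˡ a = begin
    ⌊ 0 ⌋ +F a                ≡⟨ cong (⌊ 0 ⌋ +F_) (sym (reduce-toℕ a)) ⟩
    ⌊ 0 ⌋ +F ⌊ toℕ a ⌋        ≡⟨ sym (reduce-+ 0 (toℕ a)) ⟩
    ⌊ toℕ a ⌋                 ≡⟨ reduce-toℕ a ⟩
    a                         ∎

  *F-identityˡ : ∀ a → 1F *F a ≡ a
  *F-identityˡ a = begin
    ⌊ 1 ⌋ *F a                ≡⟨ cong (⌊ 1 ⌋ *F_) (sym (reduce-toℕ a)) ⟩
    ⌊ 1 ⌋ *F ⌊ toℕ a ⌋        ≡⟨ sym (reduce-* 1 (toℕ a)) ⟩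
    ⌊ 1 ℕ.* toℕ a ⌋           ≡⟨ cong ⌊_⌋ (NP.*-identityˡ (toℕ a)) ⟩
    ⌊ toℕ a ⌋                 ≡⟨ reduce-toℕ a ⟩
    a                         ∎

  -F-inverseʳ : ∀ a → a +F (-F a) ≡ 0F
  -F-inverseʳ a = begin
    a +F ⌊ p ∸ x ⌋            ≡⟨ cong (_+F ⌊ p ∸ x ⌋) (sym (reduce-toℕ a)) ⟩
    ⌊ x ⌋ +F ⌊ p ∸ x ⌋        ≡⟨ sym (reduce-+ x (p ∸ x)) ⟩
    ⌊ x ℕ.+ (p ∸ x) ⌋         ≡⟨ cong ⌊_⌋ (NP.m+[n∸m]≡n (NP.<⇒≤ (toℕ<n a))) ⟩
    ⌊ p ⌋                     ≡⟨ reduce-% (trans (n%n≡0 p) (sym (m*n%n≡0 0 p))) ⟩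
    ⌊ 0 ⌋                     ∎
    where
    x : ℕ
    x = toℕ a

  isCommutativeRing : IsCommutativeRing _≡_ _+F_ _*F_ -F_ 0F 1F
  isCommutativeRing = record
    { isRing = record
      { +-isAbelianGroup = record
        { isGroup = record
          { isMonoid = record
            { isSemigroup = record
              { isMagma = record { isEquivalence = isEquivalence ; ∙-cong = cong₂ _+F_ }
              ; assoc = +F-assoc }
            ; identity = comm∧idˡ⇒id +F-comm +F-identityˡ }
          ; inverse = comm∧invʳ⇒inv +F-comm -F-inverseʳ
          ; ⁻¹-cong = cong -F_ }
        ; comm = +F-comm }
      ; *-cong = cong₂ _*F_
      ; *-assoc = *F-assoc
      ; *-identity = comm∧idˡ⇒id *F-comm *F-identityˡ
      ; distrib = *F-distribˡ , comm∧distrˡ⇒distrʳ *F-comm *F-distribˡ }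
    ; *-comm = *F-comm }

  ring : CommutativeRing 0ℓ 0ℓ
  ring = record { isCommutativeRing = isCommutativeRing }

module ResidueField (p : ℕ) .{{_ : NonZero p}} (p-prime : Prime p) where
  open Zp p
  open ResidueRing p

  toℕ-0F : toℕ 0F ≡ 0
  toℕ-0F = trans (toℕ-reduce 0) (m*n%n≡0 0 p)

  -- since p > 1, the residues of 1 and 0 differ
  1F≢0F : 1F ≢ 0F
  1F≢0F 1≡0 = 1≢0 (begin
    1          ≡⟨ sym (m<n⇒m%n≡m (nonTrivial⇒n>1 p {{prime⇒nonTrivial p-prime}})) ⟩
    1 % p      ≡⟨ sym (toℕ-reduce 1) ⟩
    toℕ 1F     ≡⟨ cong toℕ 1≡0 ⟩
    toℕ 0F     ≡⟨ toℕ-0F ⟩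
    0          ∎)
    where
    1≢0 : 1 ≢ 0
    1≢0 ()

  divisible⇒zero : ∀ a → p ∣ toℕ a → a ≡ 0F
  divisible⇒zero a p∣a = toℕ-injective (begin
    toℕ a      ≡⟨ sym (m<n⇒m%n≡m (toℕ<n a)) ⟩
    toℕ a % p  ≡⟨ n∣m⇒m%n≡0 (toℕ a) p p∣a ⟩
    0          ≡⟨ sym toℕ-0F ⟩
    toℕ 0F     ∎)

  no-zero-divisors : ∀ a b → a *F b ≡ 0F → a ≡ 0F ⊎ b ≡ 0F
  no-zero-divisors a b ab≡0 =
    Sum.map (divisible⇒zero a) (divisible⇒zero b) (euclidsLemma (toℕ a) (toℕ b) p-prime p∣ab)
    where
    p∣ab : p ∣ toℕ a ℕ.* toℕ b
    p∣ab = m%n≡0⇒n∣m _ p (trans (sym (toℕ-reduce _)) (trans (cong toℕ ab≡0) toℕ-0F))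

  cancel-nonzero : ∀ a b → a *F b ≡ 0F → b ≢ 0F → a ≡ 0F
  cancel-nonzero a b ab≡0 b≢0 = Sum.[ id , (λ b≡0 → ⊥-elim (b≢0 b≡0)) ] (no-zero-divisors a b ab≡0)

module Combinations (p : ℕ) .{{_ : NonZero p}} where
  open Zp p
  open ResidueRing p
  open CommutativeRing ring using (+-identityʳ; zeroˡ; zeroʳ; *-assoc)
  open import Algebra.Properties.Semiring.Sum (CommutativeRing.semiring ring)
    using (sum; ∑-comm; *-distribˡ-sum; *-distribʳ-sum; sum-cong-≗)

  lincomb-entry-sum : ∀ {k m} (c : Fin k → F) (v : Fin k → Vec m) j →
    lincomb c v j ≡ sum (λ l → c l *F v l j)
  lincomb-entry-sum {zero}  c v j = refl
  lincomb-entry-sum {suc k} c v j = cong ((c zero *F v zero j) +F_) (lincomb-entry-sum (c ∘ suc) (v ∘ suc) j)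

  lincomb-entry : ∀ {k m m'} (c : Fin k → F) {v : Fin k → Vec m} {w : Fin k → Vec m'} j j' →
    (∀ l → v l j ≡ w l j') → lincomb c v j ≡ lincomb c w j'
  lincomb-entry {zero}  c j j' eq = refl
  lincomb-entry {suc k} c j j' eq =
    cong₂ _+F_ (cong (c zero *F_) (eq zero)) (lincomb-entry (c ∘ suc) j j' (eq ∘ suc))

  lincomb-congᶜ : ∀ {k m} {c c' : Fin k → F} (v : Fin k → Vec m) →
    (∀ l → c l ≡ c' l) → lincomb c v ≈ lincomb c' v
  lincomb-congᶜ {zero}  v eq j = refl
  lincomb-congᶜ {suc k} v eq j =
    cong₂ _+F_ (cong (_*F v zero j) (eq zero)) (lincomb-congᶜ (v ∘ suc) (eq ∘ suc) j)

  lincomb-zero-entry : ∀ {k m} (c : Fin k → F) (v : Fin k → Vec m) j →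
    (∀ l → v l j ≡ 0F) → lincomb c v j ≡ 0F
  lincomb-zero-entry {zero}  c v j v≡0 = refl
  lincomb-zero-entry {suc k} c v j v≡0 = begin
    (c zero *F v zero j) +F lincomb (c ∘ suc) (v ∘ suc) j
      ≡⟨ cong₂ _+F_ (trans (cong (c zero *F_) (v≡0 zero)) (zeroʳ (c zero)))
                    (lincomb-zero-entry (c ∘ suc) (v ∘ suc) j (v≡0 ∘ suc)) ⟩
    0F +F 0F  ≡⟨ +-identityʳ 0F ⟩
    0F        ∎

  lincomb-zero-coefficients : ∀ {k m} (v : Fin k → Vec m) → lincomb (λ _ → 0F) v ≈ zeroV
  lincomb-zero-coefficients {zero}  v j = refl
  lincomb-zero-coefficients {suc k} v j = begin
    (0F *F v zero j) +F lincomb (λ _ → 0F) (v ∘ suc) j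
      ≡⟨ cong₂ _+F_ (zeroˡ (v zero j)) (lincomb-zero-coefficients (v ∘ suc) j) ⟩
    0F +F 0F  ≡⟨ +-identityʳ 0F ⟩
    0F        ∎

  lincomb-assoc : ∀ {a k m} (d : Fin a → F) (x : Fin a → Vec k) (B : Fin k → Vec m) →
    lincomb (lincomb d x) B ≈ lincomb d (λ i → lincomb (x i) B)
  lincomb-assoc d x B j = begin
    lincomb (lincomb d x) B j                         ≡⟨ lincomb-entry-sum _ B j ⟩
    sum (λ l → lincomb d x l *F B l j)                ≡⟨ sum-cong-≗ (λ l → cong (_*F B l j) (lincomb-entry-sum d x l)) ⟩
    sum (λ l → sum (λ i → d i *F x i l) *F B l j)     ≡⟨ sum-cong-≗ (λ l → *-distribʳ-sum (B l j) (λ i → d i *F x i l)) ⟩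
    sum (λ l → sum (λ i → (d i *F x i l) *F B l j)) ≡⟨ ∑-comm (λ l i → (d i *F x i l) *F B l j) ⟩
    sum (λ i → sum (λ l → (d i *F x i l) *F B l j)) ≡⟨ sum-cong-≗ (λ i → sum-cong-≗ (λ l → *-assoc (d i) (x i l) (B l j))) ⟩
    sum (λ i → sum (λ l → d i *F (x i l *F B l j)))   ≡⟨ sum-cong-≗ (λ i → sym (*-distribˡ-sum (d i) (λ l → x i l *F B l j))) ⟩
    sum (λ i → d i *F sum (λ l → x i l *F B l j))     ≡⟨ sum-cong-≗ (λ i → cong (d i *F_) (sym (lincomb-entry-sum (x i) B j))) ⟩
    sum (λ i → d i *F lincomb (x i) B j)              ≡⟨ sym (lincomb-entry-sum d _ j) ⟩
    lincomb d (λ i → lincomb (x i) B) j               ∎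

  ⊛-lincomb : ∀ {n m k} (A : Matrix n m) (d : Fin k → F) (B : Fin k → Vec m) →
    (A ⊛ lincomb d B) ≈ lincomb d (λ l → A ⊛ B l)
  ⊛-lincomb A d B = lincomb-assoc d B (λ j i → A i j)

-- Dimension of ℤ_p^m: an independent family has at most m members (by Gaussian
-- elimination), a spanning family at least m, so every basis has exactly m members.
module LinearIndependence (p : ℕ) .{{_ : NonZero p}} (p-prime : Prime p) where
  open Zp p
  open ResidueRing p
  open ResidueField p p-prime
  open Combinations p
  open CommutativeRing ring
    using (+-identityˡ; +-identityʳ; +-comm; zeroˡ; zeroʳ; *-identityʳ; *-assoc; *-comm; distribˡ; -‿inverseʳ)
  open import Algebra.Properties.Ring (CommutativeRing.ring ring) using (-‿distribˡ-*)
  open import Algebra.Properties.Semiring.Sum (CommutativeRing.semiring ring)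
    using (sum; ∑-distrib-+; *-distribʳ-sum; sum-cong-≗)

  unit : ∀ {m} → Fin m → Vec m
  unit zero    zero    = 1F
  unit zero    (suc _) = 0F
  unit (suc _) zero    = 0F
  unit (suc i) (suc j) = unit i j

  lincomb-unit : ∀ {m} (d : Fin m → F) → lincomb d unit ≈ d
  lincomb-unit {suc m} d zero = begin
    (d zero *F 1F) +F lincomb (d ∘ suc) (unit ∘ suc) zero
      ≡⟨ cong₂ _+F_ (*-identityʳ (d zero)) (lincomb-zero-entry (d ∘ suc) (unit ∘ suc) zero (λ _ → refl)) ⟩
    d zero +F 0F  ≡⟨ +-identityʳ (d zero) ⟩
    d zero        ∎
  lincomb-unit {suc m} d (suc j) = begin
    (d zero *F 0F) +F lincomb (d ∘ suc) (unit ∘ suc) (suc j)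
      ≡⟨ cong₂ _+F_ (zeroʳ (d zero)) (lincomb-entry (d ∘ suc) (suc j) j (λ _ → refl)) ⟩
    0F +F lincomb (d ∘ suc) unit j  ≡⟨ +-identityˡ _ ⟩
    lincomb (d ∘ suc) unit j        ≡⟨ lincomb-unit (d ∘ suc) j ⟩
    d (suc j)                       ∎

  -- the first member of an independent family is nonzero: 1·v₀ + 0·v₁ + … would vanish
  independent⇒head-nonzero : ∀ {k m} (v : Fin (suc k) → Vec m) → LinIndep v → ¬ v zero ≈ zeroV
  independent⇒head-nonzero v independent v₀≈0 = 1F≢0F (independent (unit zero) combination≈0 zero)
    where
    combination≈0 : lincomb (unit zero) v ≈ zeroV
    combination≈0 j = begin
      (1F *F v zero j) +F lincomb (λ _ → 0F) (v ∘ suc) j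
        ≡⟨ cong₂ _+F_ (trans (cong (1F *F_) (v₀≈0 j)) (zeroʳ 1F)) (lincomb-zero-coefficients (v ∘ suc) j) ⟩
      0F +F 0F  ≡⟨ +-identityʳ 0F ⟩
      0F        ∎

  zero-or-nonzero-entry : ∀ {m} (u : Vec m) → u ≈ zeroV ⊎ ∃[ j ] u j ≢ 0F
  zero-or-nonzero-entry u with any? (λ j → ¬? (u j ≟ 0F))
  ... | yes nonzero = inj₂ nonzero
  ... | no  none    = inj₁ (λ j → decidable-stable (u j ≟ 0F) (λ uj≢0 → none (j , uj≢0)))

  vanishes-around : ∀ {m} (u : Vec (suc m)) j → u j ≡ 0F → (∀ i → u (punchIn j i) ≡ 0F) → u ≈ zeroV
  vanishes-around u j uj≡0 rest≡0 i with j ≟ i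
  ... | yes refl = uj≡0
  ... | no  j≢i  = subst (λ i' → u i' ≡ 0F) (punchIn-punchOut j≢i) (rest≡0 (punchOut j≢i))

  -- Elimination with pivot α = (v₀)_j: the vectors W_l = α v_{l+1} - (v_{l+1})_j v₀
  -- vanish at coordinate j.
  cleared : ∀ {k m} → (Fin (suc k) → Vec m) → Fin m → Fin k → Vec m
  cleared v j l = (v zero j ·V v (suc l)) +V ((-F v (suc l) j) ·V v zero)

  cleared-vanishes : ∀ {k m} (v : Fin (suc k) → Vec m) j l → cleared v j l j ≡ 0F
  cleared-vanishes v j l = begin
    (α *F y) +F ((-F y) *F α)  ≡⟨ cong₂ _+F_ (*-comm α y) (sym (-‿distribˡ-* y α)) ⟩
    (y *F α) +F (-F (y *F α))  ≡⟨ -‿inverseʳ (y *F α) ⟩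
    0F                         ∎
    where
    α y : F
    α = v zero j
    y = v (suc l) j

  -- Σ_l d_l W_l is the combination of v with coefficients (Σ_l d_l β_l , d_l α), β_l = -(v_{l+1})_j
  cleared-coefficients : ∀ {k m} → (Fin (suc k) → Vec m) → Fin m → (Fin k → F) → Fin (suc k) → F
  cleared-coefficients v j d = sum (λ l → d l *F (-F v (suc l) j)) ∷ (λ l → d l *F v zero j)

  lincomb-cleared : ∀ {k m} (v : Fin (suc k) → Vec m) j (d : Fin k → F) →
    lincomb d (cleared v j) ≈ lincomb (cleared-coefficients v j d) v
  lincomb-cleared v j d i = begin
    lincomb d (cleared v j) i                     ≡⟨ lincomb-entry-sum d (cleared v j) i ⟩
    sum (λ l → d l *F ((α *F x l) +F (β l *F z))) ≡⟨ sum-cong-≗ distribute ⟩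
    sum (λ l → X l +F (Y l *F z))                 ≡⟨ ∑-distrib-+ X (λ l → Y l *F z) ⟩
    sum X +F sum (λ l → Y l *F z)                 ≡⟨ cong (sum X +F_) (sym (*-distribʳ-sum z Y)) ⟩
    sum X +F (sum Y *F z)                         ≡⟨ +-comm (sum X) (sum Y *F z) ⟩
    (sum Y *F z) +F sum X                         ≡⟨ cong ((sum Y *F z) +F_) (sym (lincomb-entry-sum _ (v ∘ suc) i)) ⟩
    lincomb (cleared-coefficients v j d) v i      ∎
    where
    α z : F
    α = v zero j
    z = v zero i
    x β X Y : Fin _ → F
    x l = v (suc l) i
    β l = -F v (suc l) j
    X l = (d l *F α) *F x l
    Y l = d l *F β l
    distribute : ∀ l → d l *F ((α *F x l) +F (β l *F z)) ≡ X l +F (Y l *F z)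
    distribute l = trans (distribˡ (d l) _ _) (cong₂ _+F_ (sym (*-assoc (d l) α (x l))) (sym (*-assoc (d l) (β l) z)))

  eliminate : ∀ {k m} → (Fin (suc k) → Vec (suc m)) → Fin (suc m) → Fin k → Vec m
  eliminate v j l = cleared v j l ∘ punchIn j

  eliminate-independent : ∀ {k m} (v : Fin (suc k) → Vec (suc m)) j →
    LinIndep v → v zero j ≢ 0F → LinIndep (eliminate v j)
  eliminate-independent v j independent α≢0 d d≈0 l =
    cancel-nonzero (d l) (v zero j) (independent c c≈0 (suc l)) α≢0
    where
    c : Fin (suc _) → F
    c = cleared-coefficients v j d
    c≈0 : lincomb c v ≈ zeroV
    c≈0 i = trans (sym (lincomb-cleared v j d i)) (vanishes-around (lincomb d (cleared v j)) j
      (lincomb-zero-entry d (cleared v j) j (cleared-vanishes v j))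
      (λ i' → trans (lincomb-entry d (punchIn j i') i' (λ _ → refl)) (d≈0 i')) i)

  -- induction on k: pick a nonzero entry j of v₀ as pivot and eliminate it
  independent⇒≤ : ∀ {k m} (v : Fin k → Vec m) → LinIndep v → k ≤ m
  independent⇒≤ {zero}  v independent = z≤n
  independent⇒≤ {suc k} {zero} v independent = ⊥-elim (independent⇒head-nonzero v independent (λ ()))
  independent⇒≤ {suc k} {suc m} v independent with zero-or-nonzero-entry (v zero)
  ... | inj₁ v₀≈0      = ⊥-elim (independent⇒head-nonzero v independent v₀≈0)
  ... | inj₂ (j , α≢0) = s≤s (independent⇒≤ (eliminate v j) (eliminate-independent v j independent α≢0))

  prepend-independent : ∀ {r n} (w : Vec n) (u : Fin r → Vec n) i →
    w i ≢ 0F → (∀ j → u j i ≡ 0F) → LinIndep u → LinIndep (w ∷ u)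
  prepend-independent w u i wᵢ≢0 uᵢ≡0 independent c c≈0 = coefficients≡0
    where
    head≡0 : c zero ≡ 0F
    head≡0 = cancel-nonzero (c zero) (w i) (begin
      c zero *F w i                             ≡⟨ sym (+-identityʳ _) ⟩
      (c zero *F w i) +F 0F                     ≡⟨ cong ((c zero *F w i) +F_) (sym (lincomb-zero-entry (c ∘ suc) u i uᵢ≡0)) ⟩
      (c zero *F w i) +F lincomb (c ∘ suc) u i  ≡⟨ c≈0 i ⟩
      0F                                        ∎) wᵢ≢0
    tail≈0 : lincomb (c ∘ suc) u ≈ zeroV
    tail≈0 i' = begin
      lincomb (c ∘ suc) u i'                      ≡⟨ sym (+-identityˡ _) ⟩
      0F +F lincomb (c ∘ suc) u i'                ≡⟨ cong (_+F lincomb (c ∘ suc) u i') (sym (trans (cong (_*F w i') head≡0) (zeroˡ (w i')))) ⟩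
      (c zero *F w i') +F lincomb (c ∘ suc) u i'  ≡⟨ c≈0 i' ⟩
      0F                                          ∎
    coefficients≡0 : ∀ l → c l ≡ 0F
    coefficients≡0 zero    = head≡0
    coefficients≡0 (suc j) = independent (c ∘ suc) tail≈0 j

  -- the coordinate vectors of e_1 … e_m with respect to a spanning family are independent
  spanning⇒≥ : ∀ {k m} (B : Fin k → Vec m) → SpansIn (λ _ → ⊤) B → m ≤ k
  spanning⇒≥ B spans = independent⇒≤ coords coords-independent
    where
    coords : Fin _ → Vec _
    coords j = proj₁ (spans (unit j) tt)
    coords-independent : LinIndep coords
    coords-independent d d≈0 j = begin
      d j                                       ≡⟨ sym (lincomb-unit d j) ⟩
      lincomb d unit j                          ≡⟨ lincomb-entry d j j (λ i → sym (proj₂ (spans (unit i) tt) j)) ⟩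
      lincomb d (λ i → lincomb (coords i) B) j  ≡⟨ sym (lincomb-assoc d coords B j) ⟩
      lincomb (lincomb d coords) B j            ≡⟨ lincomb-congᶜ B d≈0 j ⟩
      lincomb (λ _ → 0F) B j                    ≡⟨ lincomb-zero-coefficients B j ⟩
      0F                                        ∎

  basis-length : ∀ {k m} (B : Fin k → Vec m) → IsBasis B → k ≡ m
  basis-length B (independent , spans) = NP.≤-antisym (independent⇒≤ B independent) (spanning⇒≥ B spans)

module GoodFamilies (p : ℕ) .{{_ : NonZero p}} (p-prime : Prime p) {n m : ℕ} (A : Zp.Matrix p n m) where
  open Zp p
  open Combinations p
  open LinearIndependence p p-prime using (prepend-independent)
  open CommutativeRing (ResidueRing.ring p) using (+-identityˡ; zeroʳ)

  images : ∀ {k} → (Fin k → Vec m) → Fin k → Vec n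
  images B l = A ⊛ B l

  record ImageBasis {k} (B : Fin k → Vec m) : Set where
    field
      size         : ℕ
      members      : Fin size → Vec n
      member-image : ∀ j → ∃[ l ] members j ≈ (A ⊛ B l)
      independent  : LinIndep members
      spans        : ∀ d → ∃[ c ] lincomb c members ≈ lincomb d (images B)

  empty-imageBasis : (B : Fin 0 → Vec m) → ImageBasis B
  empty-imageBasis B = record
    { size = 0 ; members = λ () ; member-image = λ () ; independent = λ _ _ ()
    ; spans = λ d → (λ ()) , λ _ → refl }

  -- a kernel member contributes nothing to the span of the images
  skip-kernel-member : ∀ {k} (B : Fin (suc k) → Vec m) → InKernel A (B zero) →
    ImageBasis (B ∘ suc) → ImageBasis B
  skip-kernel-member B B₀∈K I = record
    { size = size ; members = members ; independent = independent
    ; member-image = λ j → suc (proj₁ (member-image j)) , proj₂ (member-image j)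
    ; spans = λ d → proj₁ (spans (d ∘ suc)) , λ i → trans (proj₂ (spans (d ∘ suc)) i) (sym (drop-head d i)) }
    where
    open ImageBasis I
    drop-head : ∀ d i → lincomb d (images B) i ≡ lincomb (d ∘ suc) (images (B ∘ suc)) i
    drop-head d i = begin
      (d zero *F (A ⊛ B zero) i) +F lincomb (d ∘ suc) (images (B ∘ suc)) i
        ≡⟨ cong (_+F lincomb (d ∘ suc) (images (B ∘ suc)) i) (trans (cong (d zero *F_) (B₀∈K i)) (zeroʳ (d zero))) ⟩
      0F +F lincomb (d ∘ suc) (images (B ∘ suc)) i  ≡⟨ +-identityˡ _ ⟩
      lincomb (d ∘ suc) (images (B ∘ suc)) i        ∎

  outside-S : ∀ v i → ¬ InS A v i → (A ⊛ v) i ≡ 0F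
  outside-S v i = decidable-stable ((A ⊛ v) i ≟ 0F)

  -- an i-unique member adds an image that is independent of all the others,
  -- since the other images vanish at i
  add-unique-member : ∀ {k} (B : Fin (suc k) → Vec m) i → IsUnique A B zero i →
    ImageBasis (B ∘ suc) → ImageBasis B
  add-unique-member B i (i∈S , unique) I = record
    { size = suc size
    ; members = (A ⊛ B zero) ∷ members
    ; member-image = member-image′
    ; independent = prepend-independent (A ⊛ B zero) members i i∈S members-vanish independent
    ; spans = λ d → (d zero ∷ proj₁ (spans (d ∘ suc)))
                  , λ i' → cong ((d zero *F (A ⊛ B zero) i') +F_) (proj₂ (spans (d ∘ suc)) i') }
    where
    open ImageBasis I
    member-image′ : ∀ j → ∃[ l ] ((A ⊛ B zero) ∷ members) j ≈ (A ⊛ B l)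
    member-image′ zero    = zero , λ _ → refl
    member-image′ (suc j) = suc (proj₁ (member-image j)) , proj₂ (member-image j)
    members-vanish : ∀ j → members j i ≡ 0F
    members-vanish j = trans (proj₂ (member-image j) i)
      (outside-S (B (suc (proj₁ (member-image j)))) i (unique (suc (proj₁ (member-image j))) λ ()))

  -- dropping the first member preserves A-goodness (uniqueness only gets easier)
  good-tail : ∀ {k} (B : Fin (suc k) → Vec m) → IsGood A B → IsGood A (B ∘ suc)
  good-tail B good l Bl∉K with good (suc l) Bl∉K
  ... | i , i∈S , unique = i , i∈S , λ l' l'≢l → unique (suc l') (l'≢l ∘ suc-injective)

  good⇒imageBasis : ∀ {k} (B : Fin k → Vec m) → IsGood A B →
    Σ[ I ∈ ImageBasis B ] ImageBasis.size I ℕ.+ countKernel A B ≡ k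
  good⇒imageBasis {zero} B good = empty-imageBasis B , refl
  good⇒imageBasis {suc k} B good with inKernel? A (B zero) | good⇒imageBasis (B ∘ suc) (good-tail B good)
  ... | yes B₀∈K | I , size≡ = skip-kernel-member B B₀∈K I , trans (NP.+-suc _ _) (cong suc size≡)
  ... | no  B₀∉K | I , size≡ =
    add-unique-member B (proj₁ (good zero B₀∉K)) (proj₂ (good zero B₀∉K)) I , cong suc size≡

  imageBasis⇒rank : ∀ {k} (B : Fin k → Vec m) → SpansIn (λ _ → ⊤) B →
    (I : ImageBasis B) → HasRank A (ImageBasis.size I)
  imageBasis⇒rank B spans-all I = members , in-image , independent , spans-image
    where
    open ImageBasis I
    in-image : ∀ j → InImage A (members j)
    in-image j = B (proj₁ (member-image j)) , λ i → sym (proj₂ (member-image j) i)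
    spans-image : SpansIn (InImage A) members
    spans-image y (x , Ax≈y) = c , λ i → begin
      lincomb c members i     ≡⟨ c-spans i ⟩
      lincomb d (images B) i  ≡⟨ sym (⊛-lincomb A d B i) ⟩
      (A ⊛ lincomb d B) i     ≡⟨ lincomb-congᶜ (λ j i' → A i' j) dB≈x i ⟩
      (A ⊛ x) i               ≡⟨ Ax≈y i ⟩
      y i                     ∎
      where
      d : Fin _ → F
      d = proj₁ (spans-all x tt)
      dB≈x : lincomb d B ≈ x
      dB≈x = proj₂ (spans-all x tt)
      c : Fin size → F
      c = proj₁ (spans d)
      c-spans : lincomb c members ≈ lincomb d (images B)
      c-spans = proj₂ (spans d)

proposition1 : (p : ℕ) .{{_ : NonZero p}} → Prime p →
    (n m k : ℕ) (A : Zp.Matrix p n m) (B : Fin k → Zp.Vec p m) →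
    Zp.IsBasis p B → Zp.IsGood p A B →
    Zp.HasRank p A (m ∸ Zp.countKernel p A B)
proposition1 p p-prime n m k A B basis good =
  subst (HasRank A) size≡ (imageBasis⇒rank B (proj₂ basis) I)
  where
  open Zp p
  open GoodFamilies p p-prime A
  result : Σ[ I ∈ ImageBasis B ] ImageBasis.size I ℕ.+ countKernel A B ≡ k
  result = good⇒imageBasis B good
  I : ImageBasis B
  I = proj₁ result
  size count : ℕ
  size = ImageBasis.size I
  count = countKernel A B
  size≡ : size ≡ m ∸ count
  size≡ = begin
    size                    ≡⟨ sym (NP.m+n∸n≡m size count) ⟩
    size ℕ.+ count ∸ count  ≡⟨ cong (_∸ count) (proj₂ result) ⟩
    k ∸ count               ≡⟨ cong (_∸ count) (LinearIndependence.basis-length p p-prime B basis) ⟩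
    m ∸ count               ∎
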